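{- Let $p$ be a prime, $n$ a positive integer, and $G$ a cyclic group of order $p^n$. Then the chromatic number of $OD(G)$ is $\chi(OD(G))=n+1$.
   Context: For a finite group $G$, the order divisor graph $OD(G)$ is the simple undirected graph with vertex set $G$ in which two distinct vertices $a,b$ are adjacent if and only if $o(a)\neq o(b)$ and either $o(a)\mid o(b)$ or $o(b)\mid o(a)$. $\chi$ denotes the chromatic number. -}

module Defs where

open import Level using (Level; _⊔_)
open import Algebra.Bundles using (Group)
open import Data.Nat using (ℕ; zero; suc; _≤_; _<_)
open import Data.Nat.Divisibility using (_∣_)
open import Data.Fin using (Fin)
open import Data.Product using (Σ; _×_; ∃)
open import Data.Sum using (_⊎_)
open import Relation.Nullary using (¬_)
open import Relation.Binary.PropositionalEquality as ≡ using (_≡_; _≢_)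
open import Function.Bundles using (Bijection)

module _ {c ℓ : Level} (G : Group c ℓ) where
  open Group G

  pow : Carrier → ℕ → Carrier
  pow a zero    = ε
  pow a (suc k) = a ∙ pow a k

  IsOrderOf : Carrier → ℕ → Set ℓ
  IsOrderOf a k = (1 ≤ k) × (pow a k ≈ ε) × (∀ j → 1 ≤ j → j < k → ¬ (pow a j ≈ ε))

  HasGroupOrder : ℕ → Set (c ⊔ ℓ)
  HasGroupOrder m = Bijection setoid (≡.setoid (Fin m))

  IsCyclic : Set (c ⊔ ℓ)
  IsCyclic = Σ Carrier λ g → ∀ x → Σ ℕ λ k → x ≈ pow g k

  ODAdj : Carrier → Carrier → Set ℓ
  ODAdj a b = (¬ (a ≈ b)) ×
    Σ ℕ λ k → Σ ℕ λ l → IsOrderOf a k × IsOrderOf b l × (k ≢ l) × ((k ∣ l) ⊎ (l ∣ k))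

  ODColourable : ℕ → Set (c ⊔ ℓ)
  ODColourable m = Σ (Carrier → Fin m) λ col →
    ∀ a b → ODAdj a b → col a ≢ col b

  ODChromaticNumber : ℕ → Set (c ⊔ ℓ)
  ODChromaticNumber k = ODColourable k × (∀ m → ODColourable m → k ≤ m)

-- Every element of a cyclic group of order p^n has order p^i for some i ≤ n, and elements of
-- different orders p^i and p^j are always adjacent in OD(G) (one order divides the other).
-- Colouring each element by the exponent of its order is therefore proper, and the powers
-- g^(p^(n-i)), i = 0, …, n, of a generator g form a clique of size n + 1.
module Submission where

open import Defs
open import Level using (Level)
open import Algebra.Bundles using (Group)
open import Data.Nat using (ℕ; suc; _^_; _≤_)
open import Data.Nat.Primality using (Prime)

open import Data.Nat as ℕ using (zero; _+_; _*_; _∸_; _<_; z≤n; s≤s; NonZero)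
import Data.Nat.Properties as ℕ
open import Data.Nat.Divisibility using (_∣_; divides; _∣?_; m%n≡0⇒n∣m; ∣1⇒≡1; *-cancelʳ-∣)
open import Data.Nat.DivMod using (_%_; _/_; m≡m%n+[m/n]*n; m%n<n)
open import Data.Nat.Coprimality using (Coprime; coprime-divisor)
open import Data.Nat.Primality using (prime⇒irreducible; prime⇒nonZero; prime⇒nonTrivial)
open import Data.Fin as Fin using (Fin; toℕ; fromℕ; fromℕ<; inject)
import Data.Fin.Properties as Fin
open import Data.Product using (_×_; _,_; proj₁; proj₂; ∃)
open import Data.Sum using (_⊎_; inj₁; inj₂)
open import Relation.Nullary using (¬_; Dec; yes; no; ¬?; contradiction)
open import Relation.Nullary.Decidable using (decidable-stable)
open import Relation.Unary using (Decidable)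
open import Relation.Binary using (tri<; tri≈; tri>)
open import Relation.Binary.PropositionalEquality as ≡ using (_≡_; _≢_)
open import Function using (_∘_)
open import Function.Bundles using (Bijection; Surjection)
import Algebra.Properties.Group as GroupProperties
import Algebra.Properties.Monoid.Mult as MonoidMult

∣p^n⇒≡p^i : ∀ {p} → Prime p → ∀ n {k} → k ∣ p ^ n → ∃ λ i → i ≤ n × k ≡ p ^ i
∣p^n⇒≡p^i pp zero k∣1 = 0 , z≤n , ∣1⇒≡1 k∣1
∣p^n⇒≡p^i {p} pp (suc n) {k} k∣p^[1+n] with p ∣? k
... | yes (divides q k≡q*p) =
  let i , i≤n , q≡p^i = ∣p^n⇒≡p^i pp n q∣p^n
  in suc i , s≤s i≤n , ≡.trans k≡q*p (≡.trans (≡.cong (_* p) q≡p^i) (ℕ.*-comm (p ^ i) p))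
  where
  instance
    p≢0 : NonZero p
    p≢0 = prime⇒nonZero pp
  q∣p^n : q ∣ p ^ n
  q∣p^n = *-cancelʳ-∣ p (≡.subst₂ _∣_ k≡q*p (ℕ.*-comm p (p ^ n)) k∣p^[1+n])
... | no p∤k =
  let i , i≤n , k≡p^i = ∣p^n⇒≡p^i pp n (coprime-divisor k⊥p k∣p^[1+n])
  in i , ℕ.m≤n⇒m≤1+n i≤n , k≡p^i
  where
  k⊥p : Coprime k p
  k⊥p {d} (d∣k , d∣p) with prime⇒irreducible pp d∣p
  ... | inj₁ d≡1 = d≡1
  ... | inj₂ d≡p = contradiction (≡.subst (_∣ k) d≡p d∣k) p∤k

^-injectiveʳ : ∀ {p} → 1 < p → ∀ {i j} → p ^ i ≡ p ^ j → i ≡ j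
^-injectiveʳ {p} 1<p {i} {j} p^i≡p^j with ℕ.<-cmp i j
... | tri< i<j _ _ = contradiction p^i≡p^j (ℕ.<⇒≢ (ℕ.^-monoʳ-< p 1<p i<j))
... | tri≈ _ i≡j _ = i≡j
... | tri> _ _ i>j = contradiction (≡.sym p^i≡p^j) (ℕ.<⇒≢ (ℕ.^-monoʳ-< p 1<p i>j))

m^n≡m^[n∸i]*m^i : ∀ m {i n} → i ≤ n → m ^ n ≡ m ^ (n ∸ i) * m ^ i
m^n≡m^[n∸i]*m^i m {i} {n} i≤n =
  ≡.trans (≡.cong (m ^_) (≡.sym (ℕ.m∸n+n≡m i≤n))) (ℕ.^-distribˡ-+-* m (n ∸ i) i)

^-monoʳ-∣ : ∀ m {i j} → i ≤ j → m ^ i ∣ m ^ j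
^-monoʳ-∣ m {i} {j} i≤j = divides (m ^ (j ∸ i)) (m^n≡m^[n∸i]*m^i m i≤j)

LeastPositive : ∀ {ℓ} → (ℕ → Set ℓ) → ℕ → Set ℓ
LeastPositive P k = 1 ≤ k × P k × (∀ j → 1 ≤ j → j < k → ¬ P j)

least-positive : ∀ {ℓ} {P : ℕ → Set ℓ} → Decidable P → ∀ {K} → 1 ≤ K → P K → ∃ (LeastPositive P)
least-positive {P = P} P? {suc K} _ P[1+K] =
  from-smallest (Fin.¬∀⟶∃¬-smallest (suc K) (¬_ ∘ P ∘ suc ∘ toℕ) (¬? ∘ P? ∘ suc ∘ toℕ) none)
  where
  none : ¬ (∀ (j : Fin (suc K)) → ¬ P (suc (toℕ j)))
  none all = all (fromℕ K) (≡.subst (P ∘ suc) (≡.sym (Fin.toℕ-fromℕ K)) P[1+K])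
  from-smallest : (∃ λ (i : Fin (suc K)) →
                     ¬ ¬ P (suc (toℕ i)) × ((j : Fin.Fin′ i) → ¬ P (suc (toℕ (inject j))))) →
                  ∃ (LeastPositive P)
  from-smallest (i , ¬¬P[1+i] , below) =
    suc (toℕ i) , s≤s z≤n , decidable-stable (P? _) ¬¬P[1+i] , not-below
    where
    not-below : ∀ j → 1 ≤ j → j < suc (toℕ i) → ¬ P j
    not-below (suc j) _ (s≤s j<i) = ≡.subst (¬_ ∘ P ∘ suc) toℕ-j (below (fromℕ< j<i))
      where
      toℕ-j : toℕ (inject (fromℕ< j<i)) ≡ j
      toℕ-j = ≡.trans (Fin.toℕ-inject (fromℕ< j<i)) (Fin.toℕ-fromℕ< j<i)

module _ {c ℓ : Level} (G : Group c ℓ) where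
  open Group G
  open GroupProperties G using (∙-cancelˡ)
  open import Relation.Binary.Reasoning.Setoid setoid
  -- The library develops powers in additive notation, as the monoid multiple k × a.
  open MonoidMult monoid using (×-congʳ; ×-homo-+; ×-assocˡ) renaming (_×_ to _×ᴹ_)

  pow≡×ᴹ : ∀ a k → pow G a k ≡ k ×ᴹ a
  pow≡×ᴹ a zero    = ≡.refl
  pow≡×ᴹ a (suc k) = ≡.cong (a ∙_) (pow≡×ᴹ a k)

  pow-congˡ : ∀ {a b} k → a ≈ b → pow G a k ≈ pow G b k
  pow-congˡ {a} {b} k a≈b rewrite pow≡×ᴹ a k | pow≡×ᴹ b k = ×-congʳ k a≈b

  pow-congʳ : ∀ a {m n} → m ≡ n → pow G a m ≈ pow G a n
  pow-congʳ a ≡.refl = refl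

  pow-+ : ∀ a m n → pow G a (m + n) ≈ pow G a m ∙ pow G a n
  pow-+ a m n rewrite pow≡×ᴹ a (m + n) | pow≡×ᴹ a m | pow≡×ᴹ a n = ×-homo-+ a m n

  pow-pow : ∀ a m n → pow G (pow G a m) n ≈ pow G a (n * m)
  pow-pow a m n rewrite pow≡×ᴹ (pow G a m) n | pow≡×ᴹ a m | pow≡×ᴹ a (n * m) = ×-assocˡ a n m

  pow-ε : ∀ n → pow G ε n ≈ ε
  pow-ε zero    = refl
  pow-ε (suc n) = trans (identityˡ _) (pow-ε n)

  pow-∸≈ε : ∀ a {i j} → i ≤ j → pow G a i ≈ pow G a j → pow G a (j ∸ i) ≈ ε
  pow-∸≈ε a {i} {j} i≤j aⁱ≈aʲ = ∙-cancelˡ (pow G a i) _ _ (begin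
    pow G a i ∙ pow G a (j ∸ i) ≈⟨ pow-+ a i (j ∸ i) ⟨
    pow G a (i + (j ∸ i))       ≈⟨ pow-congʳ a (ℕ.m+[n∸m]≡n i≤j) ⟩
    pow G a j                   ≈⟨ aⁱ≈aʲ ⟨
    pow G a i                   ≈⟨ identityʳ _ ⟨
    pow G a i ∙ ε               ∎)

  IsOrderOf-unique : ∀ {a k l} → IsOrderOf G a k → IsOrderOf G a l → k ≡ l
  IsOrderOf-unique {k = k} {l} (1≤k , aᵏ≈ε , k-least) (1≤l , aˡ≈ε , l-least) with ℕ.<-cmp k l
  ... | tri< k<l _ _ = contradiction aᵏ≈ε (l-least k 1≤k k<l)
  ... | tri≈ _ k≡l _ = k≡l
  ... | tri> _ _ k>l = contradiction aˡ≈ε (k-least l 1≤l k>l)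

  IsOrderOf-resp : ∀ {a b k} → a ≈ b → IsOrderOf G a k → IsOrderOf G b k
  IsOrderOf-resp {k = k} a≈b (1≤k , aᵏ≈ε , k-least) =
    1≤k , trans (sym (pow-congˡ k a≈b)) aᵏ≈ε ,
    λ j 1≤j j<k bʲ≈ε → k-least j 1≤j j<k (trans (pow-congˡ j a≈b) bʲ≈ε)

  pow-mod : ∀ {a d} → IsOrderOf G a d → .{{_ : NonZero d}} → ∀ k → pow G a k ≈ pow G a (k % d)
  pow-mod {a} {d} (_ , aᵈ≈ε , _) k = begin
    pow G a k                                  ≈⟨ pow-congʳ a (m≡m%n+[m/n]*n k d) ⟩
    pow G a (k % d + k / d * d)                ≈⟨ pow-+ a (k % d) (k / d * d) ⟩
    pow G a (k % d) ∙ pow G a (k / d * d)      ≈⟨ ∙-congˡ (pow-pow a d (k / d)) ⟨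
    pow G a (k % d) ∙ pow G (pow G a d) (k / d) ≈⟨ ∙-congˡ (pow-congˡ (k / d) aᵈ≈ε) ⟩
    pow G a (k % d) ∙ pow G ε (k / d)          ≈⟨ ∙-congˡ (pow-ε (k / d)) ⟩
    pow G a (k % d) ∙ ε                        ≈⟨ identityʳ _ ⟩
    pow G a (k % d)                            ∎

  IsOrderOf⇒∣ : ∀ {a d} → IsOrderOf G a d → ∀ k → pow G a k ≈ ε → d ∣ k
  IsOrderOf⇒∣ {d = d@(suc _)} order@(_ , _ , d-least) k aᵏ≈ε with k % d in k%d≡r | pow-mod order k
  ... | zero  | _        = m%n≡0⇒n∣m k d k%d≡r
  ... | suc r | aᵏ≈a¹⁺ʳ = contradiction (trans (sym aᵏ≈a¹⁺ʳ) aᵏ≈ε) (d-least (suc r) (s≤s z≤n) 1+r<d)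
    where
    1+r<d : suc r < d
    1+r<d = ≡.subst (_< d) k%d≡r (m%n<n k d)

  pow-distinct-<order : ∀ {a d i j} → IsOrderOf G a d → i < j → j < d → ¬ pow G a i ≈ pow G a j
  pow-distinct-<order {a} {i = i} {j} (_ , _ , d-least) i<j j<d aⁱ≈aʲ =
    d-least (j ∸ i) (ℕ.m<n⇒0<n∸m i<j) (ℕ.≤-<-trans (ℕ.m∸n≤m j i) j<d) (pow-∸≈ε a (ℕ.<⇒≤ i<j) aⁱ≈aʲ)

  pow-injective-<order : ∀ {a d i j} → IsOrderOf G a d → i < d → j < d → pow G a i ≈ pow G a j → i ≡ j
  pow-injective-<order {i = i} {j} order i<d j<d aⁱ≈aʲ with ℕ.<-cmp i j
  ... | tri< i<j _ _ = contradiction aⁱ≈aʲ (pow-distinct-<order order i<j j<d)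
  ... | tri≈ _ i≡j _ = i≡j
  ... | tri> _ _ i>j = contradiction (sym aⁱ≈aʲ) (pow-distinct-<order order i>j i<d)

  pow-IsOrderOf : ∀ {a} e f → 1 ≤ e → IsOrderOf G a (e * f) → IsOrderOf G (pow G a e) f
  pow-IsOrderOf {a} e f 1≤e@(s≤s z≤n) (1≤e*f , aᵉᶠ≈ε , ef-least) =
    ℕ.>-nonZero⁻¹ f {{ℕ.m*n≢0⇒n≢0 e {{ℕ.>-nonZero 1≤e*f}}}} ,
    trans (pow-pow a e f) (trans (pow-congʳ a (ℕ.*-comm f e)) aᵉᶠ≈ε) ,
    λ j 1≤j j<f aᵉʲ≈ε →
      ef-least (j * e) (ℕ.*-mono-≤ 1≤j 1≤e) (je<ef j<f) (trans (sym (pow-pow a e j)) aᵉʲ≈ε)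
    where
    je<ef : ∀ {j} → j < f → j * e < e * f
    je<ef j<f = ℕ.<-≤-trans (ℕ.*-monoˡ-< e j<f) (ℕ.≤-reflexive (ℕ.*-comm f e))

  ODAdj-byOrders : ∀ {a b k l} → IsOrderOf G a k → IsOrderOf G b l →
                   k ≢ l → (k ∣ l) ⊎ (l ∣ k) → ODAdj G a b
  ODAdj-byOrders oa ob k≢l k∣l⊎l∣k =
    (λ a≈b → k≢l (IsOrderOf-unique (IsOrderOf-resp a≈b oa) ob)) , _ , _ , oa , ob , k≢l , k∣l⊎l∣k

  ODColourable-byOrders : ∀ {m} (q : Fin m → ℕ) → (∀ a → ∃ λ i → IsOrderOf G a (q i)) →
                          ODColourable G m
  ODColourable-byOrders q order = proj₁ ∘ order , proper
    where
    proper : ∀ a b → ODAdj G a b → proj₁ (order a) ≢ proj₁ (order b)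
    proper a b (_ , k , l , oa , ob , k≢l , _) iₐ≡iᵦ =
      k≢l (≡.trans (IsOrderOf-unique oa (proj₂ (order a)))
          (≡.trans (≡.cong q iₐ≡iᵦ) (IsOrderOf-unique (proj₂ (order b)) ob)))

  ODClique⇒≤colours : ∀ {k m} (h : Fin k → Carrier) → (∀ i j → i ≢ j → ODAdj G (h i) (h j)) →
                      ODColourable G m → k ≤ m
  ODClique⇒≤colours h clique (col , proper) = Fin.injective⇒≤ {f = col ∘ h} injective
    where
    injective : ∀ {i j} → col (h i) ≡ col (h j) → i ≡ j
    injective {i} {j} colᵢ≡colⱼ with i Fin.≟ j
    ... | yes i≡j = i≡j
    ... | no  i≢j = contradiction colᵢ≡colⱼ (proper (h i) (h j) (clique i j i≢j))

  module _ {m} (|G|≡m : HasGroupOrder G m) where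
    open Bijection |G|≡m
    open Surjection surjection using (to∘to⁻)

    _≈?_ : ∀ x y → Dec (x ≈ y)
    x ≈? y with to x Fin.≟ to y
    ... | yes tox≡toy = yes (injective tox≡toy)
    ... | no  tox≢toy = no (tox≢toy ∘ cong)

    IsOrderOf-exists : ∀ a → ∃ (IsOrderOf G a)
    IsOrderOf-exists a
      with i , j , i<j , aⁱ≡aʲ ← Fin.pigeonhole (ℕ.n<1+n m) (λ i → to (pow G a (toℕ i)))
      = least-positive (λ k → pow G a k ≈? ε) (ℕ.m<n⇒0<n∸m i<j)
          (pow-∸≈ε a (ℕ.<⇒≤ i<j) (injective aⁱ≡aʲ))

    generator-IsOrderOf : ((g , _) : IsCyclic G) → IsOrderOf G g m
    generator-IsOrderOf (g , generates) with d , order ← IsOrderOf-exists g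
      = ≡.subst (IsOrderOf G g) (ℕ.≤-antisym d≤m m≤d) order
      where
      instance
        d≢0 : NonZero d
        d≢0 = ℕ.>-nonZero (proj₁ order)
      d≤m : d ≤ m
      d≤m = Fin.injective⇒≤ {f = λ i → to (pow G g (toℕ i))}
        (λ gⁱ≡gʲ → Fin.toℕ-injective
          (pow-injective-<order order (Fin.toℕ<n _) (Fin.toℕ<n _) (injective gⁱ≡gʲ)))
      log : Carrier → Fin d
      log x = fromℕ< (m%n<n (proj₁ (generates x)) d)
      g^log : ∀ x → x ≈ pow G g (toℕ (log x))
      g^log x = let k , x≈gᵏ = generates x in
        trans x≈gᵏ (trans (pow-mod order k) (pow-congʳ g (≡.sym (Fin.toℕ-fromℕ< (m%n<n k d)))))
      log-injective : ∀ {x x′} → log x ≡ log x′ → x ≈ x′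
      log-injective {x} {x′} logx≡logx′ =
        trans (g^log x) (trans (pow-congʳ g (≡.cong toℕ logx≡logx′)) (sym (g^log x′)))
      m≤d : m ≤ d
      m≤d = Fin.injective⇒≤ {f = log ∘ to⁻} λ {y} {z} logy≡logz →
        ≡.trans (≡.sym (to∘to⁻ y)) (≡.trans (cong (log-injective logy≡logz)) (to∘to⁻ z))

    pow-groupOrder≈ε : IsCyclic G → ∀ a → pow G a m ≈ ε
    pow-groupOrder≈ε gen@(g , generates) a = let k , a≈gᵏ = generates a in begin
      pow G a m                ≈⟨ pow-congˡ m a≈gᵏ ⟩
      pow G (pow G g k) m      ≈⟨ pow-pow g k m ⟩
      pow G g (m * k)          ≈⟨ pow-congʳ g (ℕ.*-comm m k) ⟩
      pow G g (k * m)          ≈⟨ pow-pow g m k ⟨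
      pow G (pow G g m) k      ≈⟨ pow-congˡ k (proj₁ (proj₂ (generator-IsOrderOf gen))) ⟩
      pow G ε k                ≈⟨ pow-ε k ⟩
      ε                        ∎

module _ {c ℓ : Level} (G : Group c ℓ) {p n} (pp : Prime p)
         (|G|≡pⁿ : HasGroupOrder G (p ^ n)) (gen : IsCyclic G) where
  open Group G

  IsOrderOf-prime-power : ∀ a → ∃ λ (i : Fin (suc n)) → IsOrderOf G a (p ^ toℕ i)
  IsOrderOf-prime-power a = let k , order = IsOrderOf-exists G |G|≡pⁿ a in
    prime-power-order order
      (∣p^n⇒≡p^i pp n (IsOrderOf⇒∣ G order (p ^ n) (pow-groupOrder≈ε G |G|≡pⁿ gen a)))
    where
    prime-power-order : ∀ {k} → IsOrderOf G a k → (∃ λ i → i ≤ n × k ≡ p ^ i) →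
                        ∃ λ (i : Fin (suc n)) → IsOrderOf G a (p ^ toℕ i)
    prime-power-order order (i , i≤n , k≡pⁱ) = fromℕ< (s≤s i≤n) ,
      ≡.subst (IsOrderOf G a) (≡.trans k≡pⁱ (≡.cong (p ^_) (≡.sym (Fin.toℕ-fromℕ< (s≤s i≤n))))) order

  element-of-order-p^ : Fin (suc n) → Carrier
  element-of-order-p^ i = pow G (proj₁ gen) (p ^ (n ∸ toℕ i))

  element-of-order-p^-IsOrderOf : ∀ i → IsOrderOf G (element-of-order-p^ i) (p ^ toℕ i)
  element-of-order-p^-IsOrderOf i =
    pow-IsOrderOf G (p ^ (n ∸ toℕ i)) (p ^ toℕ i) (ℕ.m^n>0 p {{prime⇒nonZero pp}} (n ∸ toℕ i))
      (≡.subst (IsOrderOf G (proj₁ gen)) (m^n≡m^[n∸i]*m^i p (ℕ.s≤s⁻¹ (Fin.toℕ<n i)))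
        (generator-IsOrderOf G |G|≡pⁿ gen))

  elements-of-order-p^-clique : ∀ i j → i ≢ j →
                                ODAdj G (element-of-order-p^ i) (element-of-order-p^ j)
  elements-of-order-p^-clique i j i≢j =
    ODAdj-byOrders G (element-of-order-p^-IsOrderOf i) (element-of-order-p^-IsOrderOf j)
      pⁱ≢pʲ pⁱ∣pʲ⊎pʲ∣pⁱ
    where
    pⁱ≢pʲ : p ^ toℕ i ≢ p ^ toℕ j
    pⁱ≢pʲ = i≢j ∘ Fin.toℕ-injective ∘ ^-injectiveʳ (ℕ.nonTrivial⇒n>1 p {{prime⇒nonTrivial pp}})
    pⁱ∣pʲ⊎pʲ∣pⁱ : (p ^ toℕ i ∣ p ^ toℕ j) ⊎ (p ^ toℕ j ∣ p ^ toℕ i)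
    pⁱ∣pʲ⊎pʲ∣pⁱ with ℕ.≤-total (toℕ i) (toℕ j)
    ... | inj₁ i≤j = inj₁ (^-monoʳ-∣ p i≤j)
    ... | inj₂ j≤i = inj₂ (^-monoʳ-∣ p j≤i)

corollary6 : {c ℓ : Level} (G : Group c ℓ) (p n : ℕ) → Prime p → 1 ≤ n →
    HasGroupOrder G (p ^ n) → IsCyclic G → ODChromaticNumber G (suc n)
corollary6 G p n pp _ |G|≡pⁿ gen =
  ODColourable-byOrders G (λ i → p ^ toℕ i) (IsOrderOf-prime-power G pp |G|≡pⁿ gen) ,
  λ _ → ODClique⇒≤colours G (element-of-order-p^ G pp |G|≡pⁿ gen)
          (elements-of-order-p^-clique G pp |G|≡pⁿ gen)
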